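{- Let $f$ be a $k$-ary function symbol and let $t=\mathrm{SUM}_{\bar x}(f(\bar y),\gamma)$ be an aggregate sum term of $\mathrm{FO}_{\mathbb{R}_{\geq0}}(\mathrm{SUM}^*)$ over $\tau_0\cup\{\leq\}\cup\{f\}$ (so $\bar x,\bar y$ are tuples of distinct variables with $\mathrm{Var}(\bar x)\subseteq\mathrm{Var}(\bar y)$, $|\bar y|=k$, and $\gamma$ is a quantifier-free $\tau_0$-formula built from atomic formulas with $\neg,\wedge,\vee$). Then there are a tuple $\bar u=(u_1,\dots,u_k)$ of distinct variables and a quantifier-free formula $\delta$ built from atomic $\tau_0$-formulas using only $\neg$ and $\wedge$ such that for every $\mathbb{R}_{\geq0}$-structure $\mathcal{A}$ and every assignment $s$ (defined on the free variables of both terms), $[t]_s^{\mathcal{A}}=[\mathrm{SUM}_{\bar u}(f(\bar u),\delta)]_s^{\mathcal{A}}$.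
   Context: $\tau_0$ is a finite vocabulary of relation and constant symbols containing equality. An $\mathbb{R}_{\geq0}$-structure is $\mathcal{A}=(\mathcal{A}_0,(\mathbb{R}_{\geq0},\leq),\{f^{\mathcal{A}}\})$ with $\mathcal{A}_0$ a finite $\tau_0$-structure and $f^{\mathcal{A}}\colon A_0^k\to\mathbb{R}_{\geq0}$; assignments map first-order variables into $A_0$. For a sum term, $[\mathrm{SUM}_{\bar x}(f(\bar y),\gamma)]_s^{\mathcal{A}}=\sum_{\bar a\in A_0^{|\bar x|},\ \mathcal{A}_0\models_{s(\bar a/\bar x)}\gamma}f^{\mathcal{A}}(s(\bar a/\bar x)(\bar y))$, where $s(\bar a/\bar x)$ is $s$ modified to send $\bar x$ to $\bar a$ (for empty $\bar x$ the sum has one index, the empty tuple). -}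

module Defs where

open import Level using (0ℓ)
open import Data.Nat using (ℕ; _≡ᵇ_)
open import Data.Fin using (Fin; _≟_)
open import Data.Bool using (Bool; true; false; not; _∧_; _∨_; if_then_else_)
open import Data.Vec using (Vec; []; _∷_; map)
open import Data.List using (List; []; _∷_; concatMap; foldr)
open import Data.Unit using (⊤)
open import Data.Product using (_×_)
open import Relation.Nullary.Decidable using (⌊_⌋)
open import Algebra.Bundles using (CommutativeMonoid)

record Vocab : Set where
  field
    nRel   : ℕ
    arity  : Fin nRel → ℕ
    nConst : ℕ
open Vocab public

Var : Set
Var = ℕ

data Term (τ : Vocab) : Set where
  var : Var → Term τ
  con : Fin (nConst τ) → Term τ

data QF (τ : Vocab) : Set where
  rel  : (R : Fin (nRel τ)) → Vec (Term τ) (arity τ R) → QF τ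
  eq   : Term τ → Term τ → QF τ
  neg  : QF τ → QF τ
  and  : QF τ → QF τ → QF τ
  or   : QF τ → QF τ → QF τ

data NegAnd {τ : Vocab} : QF τ → Set where
  rel : ∀ R ts → NegAnd (rel R ts)
  eq  : ∀ t₁ t₂ → NegAnd (eq t₁ t₂)
  neg : ∀ {φ} → NegAnd φ → NegAnd (neg φ)
  and : ∀ {φ ψ} → NegAnd φ → NegAnd ψ → NegAnd (and φ ψ)

record Structure (τ : Vocab) (n : ℕ) : Set where
  field
    relI   : (R : Fin (nRel τ)) → Vec (Fin n) (arity τ R) → Bool
    constI : Fin (nConst τ) → Fin n
open Structure public

Assignment : ℕ → Set
Assignment n = Var → Fin n

evalTerm : ∀ {τ n} → Structure τ n → Assignment n → Term τ → Fin n
evalTerm 𝒜 s (var x) = s x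
evalTerm 𝒜 s (con c) = constI 𝒜 c

sat : ∀ {τ n} → Structure τ n → Assignment n → QF τ → Bool
sat 𝒜 s (rel R ts) = relI 𝒜 R (map (evalTerm 𝒜 s) ts)
sat 𝒜 s (eq t₁ t₂) = ⌊ evalTerm 𝒜 s t₁ ≟ evalTerm 𝒜 s t₂ ⌋
sat 𝒜 s (neg φ)    = not (sat 𝒜 s φ)
sat 𝒜 s (and φ ψ)  = sat 𝒜 s φ ∧ sat 𝒜 s ψ
sat 𝒜 s (or φ ψ)   = sat 𝒜 s φ ∨ sat 𝒜 s ψ

update : ∀ {n m} → Assignment n → Vec Var m → Vec (Fin n) m → Assignment n
update s []       []       = s
update s (x ∷ xs) (a ∷ as) = λ v → if v ≡ᵇ x then a else update s xs as v

allTuples : (n m : ℕ) → List (Vec (Fin n) m)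
allTuples n ℕ.zero    = [] ∷ []
allTuples n (ℕ.suc m) =
  concatMap (λ a → Data.List.map (a ∷_) (allTuples n m)) (Data.List.allFin n)

-- Semantics of SUM_x̄ (f(ȳ), γ), with values in a commutative monoid M
-- (standing in for (ℝ≥0, +, 0)); F is the interpretation of the k-ary f.
sumTerm : (M : CommutativeMonoid 0ℓ 0ℓ) → ∀ {τ n m k} →
          Structure τ n → (Vec (Fin n) k → CommutativeMonoid.Carrier M) →
          Assignment n → Vec Var m → Vec Var k → QF τ →
          CommutativeMonoid.Carrier M
sumTerm M {τ} {n} {m} 𝒜 F s xs ys γ =
  foldr (λ as acc → let s' = update s xs as in
                    if sat 𝒜 s' γ then F (map s' ys) ∙ acc else acc)
        ε (allTuples n m)
  where open CommutativeMonoid M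

module Submission where

-- Sum instead over fresh variables u₁ … u_k, one per position of ȳ.  Reading ȳ off s(ā/x̄)
-- gives φ ā, and reading x̄ off s(b̄/ū) through the renaming σ : xⱼ ↦ u_{i(j)} (with y_{i(j)} = xⱼ)
-- gives ψ b̄; then ψ ∘ φ = id, so summing over ā is summing over the b̄ with b̄ = φ (ψ b̄).
-- That equation is the conjunction of the equalities uᵢ = σ yᵢ, and since ū is fresh for γ,
-- σ γ holds at b̄ iff γ holds at ψ b̄.  Repetitions in ȳ
-- do no harm.

open import Defs
open import Level using (0ℓ)
open import Data.Nat using (ℕ; zero; suc; _+_; _≡ᵇ_; _<_; _≤_; _⊔_)
open import Data.Nat.Properties using (m≤m⊔n; m≤n⊔m; <-≤-trans; ≤-refl; <⇒≱; m≤m+n; +-cancelˡ-≡)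
import Data.Nat.Properties as ℕₚ
open import Data.Fin using (Fin; zero; suc; toℕ)
open import Data.Fin.Properties using (_≟_; toℕ-injective)
open import Data.Bool using (Bool; true; false; not; _∧_; _∨_; if_then_else_)
open import Data.Bool.Properties using (not-involutive; ∨-∧-booleanAlgebra; if-∧; if-cong)
open import Algebra.Lattice.Properties.BooleanAlgebra ∨-∧-booleanAlgebra using (deMorgan₁)
open import Data.Vec using (Vec; []; _∷_; map; lookup; tabulate)
open import Data.Vec.Properties using (≡-dec; lookup-map; map-∘; map-cong; lookup∘tabulate)
open import Data.Vec.Relation.Unary.All using (All)
open import Data.Vec.Relation.Unary.All.Properties using (lookup⁺)
open import Data.Vec.Relation.Unary.Any using (here; there; index)
open import Data.Vec.Relation.Unary.Any.Properties using (lookup-index)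
open import Data.Vec.Membership.Propositional using (_∈_; _∉_)
open import Data.Vec.Membership.DecPropositional ℕₚ._≟_ using (_∈?_)
open import Data.Vec.Relation.Unary.Unique.Propositional using (Unique)
open import Data.Vec.Relation.Unary.Unique.Propositional.Properties using (tabulate⁺)
open import Data.Vec.Relation.Unary.AllPairs using (_∷_)
open import Data.Vec.Relation.Binary.Pointwise.Extensional using (ext; Pointwise-≡⇒≡)
open import Data.List as List using (List; []; _∷_; _++_; concatMap; foldr; allFin)
open import Data.List.Properties using (map-tabulate)
open import Data.Product using (Σ; _×_; _,_)
open import Function using (_∘_; id; mk⇔)
open import Relation.Nullary.Decidable using (does; isYes; yes; no; dec-true; dec-false; does-⇔; isYes≗does)
open import Relation.Binary.PropositionalEquality
  using (_≡_; refl; sym; trans; cong; cong₂; subst; module ≡-Reasoning)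
open import Relation.Binary.Definitions using (DecidableEquality)
open import Algebra.Bundles using (CommutativeMonoid)

_≟ᵥ_ : ∀ {n k} → DecidableEquality (Vec (Fin n) k)
_≟ᵥ_ = ≡-dec _≟_

module Sums (M : CommutativeMonoid 0ℓ 0ℓ) where
  open CommutativeMonoid M renaming (Carrier to C; refl to ≈-refl; sym to ≈-sym; trans to ≈-trans)
  open import Algebra.Properties.CommutativeSemigroup commutativeSemigroup using (interchange)
  open import Relation.Binary.Reasoning.Setoid setoid

  ∑ : {A : Set} → List A → (A → C) → C
  ∑ L w = foldr (λ a acc → w a ∙ acc) ε L

  syntax ∑ L (λ a → w) = ∑[ a ∈ L ] w

  ∑-cong : {A : Set} (L : List A) {v w : A → C} → (∀ a → v a ≈ w a) → ∑ L v ≈ ∑ L w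
  ∑-cong []      v≈w = ≈-refl
  ∑-cong (a ∷ L) v≈w = ∙-cong (v≈w a) (∑-cong L v≈w)

  ∑-ε : {A : Set} (L : List A) → ∑[ _ ∈ L ] ε ≈ ε
  ∑-ε []      = ≈-refl
  ∑-ε (a ∷ L) = ≈-trans (identityˡ _) (∑-ε L)

  foldr-if≈∑ : {A : Set} (L : List A) (c : A → Bool) (w : A → C) →
         foldr (λ a acc → if c a then w a ∙ acc else acc) ε L ≈ ∑[ a ∈ L ] (if c a then w a else ε)
  foldr-if≈∑ []      c w = ≈-refl
  foldr-if≈∑ (a ∷ L) c w with c a
  ... | true  = ∙-cong ≈-refl (foldr-if≈∑ L c w)
  ... | false = ≈-trans (foldr-if≈∑ L c w) (≈-sym (identityˡ _))

  ∑-++ : {A : Set} (L₁ L₂ : List A) (w : A → C) → ∑ (L₁ ++ L₂) w ≈ ∑ L₁ w ∙ ∑ L₂ w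
  ∑-++ []       L₂ w = ≈-sym (identityˡ _)
  ∑-++ (a ∷ L₁) L₂ w = ≈-trans (∙-cong ≈-refl (∑-++ L₁ L₂ w)) (≈-sym (assoc _ _ _))

  ∑-concatMap : {A B : Set} (f : A → List B) (L : List A) (w : B → C) →
                ∑ (concatMap f L) w ≈ ∑[ a ∈ L ] ∑ (f a) w
  ∑-concatMap f []      w = ≈-refl
  ∑-concatMap f (a ∷ L) w = ≈-trans (∑-++ (f a) (concatMap f L) w) (∙-cong ≈-refl (∑-concatMap f L w))

  ∑-map : {A B : Set} (f : A → B) (L : List A) (w : B → C) → ∑ (List.map f L) w ≡ ∑ L (w ∘ f)
  ∑-map f []      w = refl
  ∑-map f (a ∷ L) w = cong (w (f a) ∙_) (∑-map f L w)

  ∑-∙ : {A : Set} (L : List A) (v w : A → C) → ∑[ a ∈ L ] (v a ∙ w a) ≈ ∑ L v ∙ ∑ L w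
  ∑-∙ []      v w = ≈-sym (identityˡ _)
  ∑-∙ (a ∷ L) v w = ≈-trans (∙-cong ≈-refl (∑-∙ L v w)) (interchange _ _ _ _)

  ∑-comm : {A B : Set} (L₁ : List A) (L₂ : List B) (h : A → B → C) →
           ∑[ a ∈ L₁ ] ∑[ b ∈ L₂ ] h a b ≈ ∑[ b ∈ L₂ ] ∑[ a ∈ L₁ ] h a b
  ∑-comm []       L₂ h = ≈-sym (∑-ε L₂)
  ∑-comm (a ∷ L₁) L₂ h = ≈-trans (∙-cong ≈-refl (∑-comm L₁ L₂ h)) (≈-sym (∑-∙ L₂ (h a) _))

  ∑-allFin-suc : ∀ n (w : Fin (suc n) → C) → ∑ (allFin (suc n)) w ≡ w zero ∙ ∑ (allFin n) (w ∘ suc)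
  ∑-allFin-suc n w =
    cong (w zero ∙_) (trans (cong (λ L → ∑ L w) (sym (map-tabulate id suc))) (∑-map suc (allFin n) w))

  ∑-allFin-indicator : ∀ {n} (c : Fin n) (x : C) → ∑[ a ∈ allFin n ] (if does (a ≟ c) then x else ε) ≈ x
  ∑-allFin-indicator {suc n} zero x = begin
    _                ≡⟨ ∑-allFin-suc n _ ⟩
    x ∙ ∑[ _ ∈ allFin n ] ε ≈⟨ ∙-cong ≈-refl (∑-ε (allFin n)) ⟩
    x ∙ ε            ≈⟨ identityʳ x ⟩
    x                ∎
  ∑-allFin-indicator {suc n} (suc c) x = begin
    _                ≡⟨ ∑-allFin-suc n _ ⟩
    ε ∙ _            ≈⟨ identityˡ _ ⟩
    _                ≈⟨ ∑-allFin-indicator c x ⟩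
    x                ∎

  ∑-allTuples-indicator : ∀ {n k} (c : Vec (Fin n) k) (x : C) →
                          ∑[ b ∈ allTuples n k ] (if does (b ≟ᵥ c) then x else ε) ≈ x
  ∑-allTuples-indicator {n} {zero}  []       x = identityʳ x
  ∑-allTuples-indicator {n} {suc k} (c ∷ cs) x = begin
    _ ≈⟨ ∑-concatMap _ (allFin n) _ ⟩
    ∑[ a ∈ allFin n ] ∑ (List.map (a ∷_) (allTuples n k)) _
      ≈⟨ ∑-cong (allFin n) row ⟩
    ∑[ a ∈ allFin n ] (if does (a ≟ c) then x else ε)
      ≈⟨ ∑-allFin-indicator c x ⟩
    x ∎
    where
    row : ∀ a → ∑[ b ∈ List.map (a ∷_) (allTuples n k) ] (if does (b ≟ᵥ (c ∷ cs)) then x else ε)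
                ≈ (if does (a ≟ c) then x else ε)
    row a rewrite ∑-map (a ∷_) (allTuples n k) (λ b → if does (b ≟ᵥ (c ∷ cs)) then x else ε)
      with does (a ≟ c)
    ... | true  = ∑-allTuples-indicator cs x
    ... | false = ∑-ε (allTuples n k)

  ∑-image : ∀ {n m k} (φ : Vec (Fin n) m → Vec (Fin n) k) (ψ : Vec (Fin n) k → Vec (Fin n) m) →
            (∀ a → ψ (φ a) ≡ a) → (g : Vec (Fin n) k → C) →
            ∑[ a ∈ allTuples n m ] g (φ a) ≈ ∑[ b ∈ allTuples n k ] (if does (b ≟ᵥ φ (ψ b)) then g b else ε)
  ∑-image {n} {m} {k} φ ψ ψ∘φ g = begin
    ∑[ a ∈ Aᵐ ] g (φ a)
      ≈⟨ ∑-cong Aᵐ (λ a → ≈-sym (∑-allTuples-indicator (φ a) (g (φ a)))) ⟩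
    ∑[ a ∈ Aᵐ ] ∑[ b ∈ Aᵏ ] (if does (b ≟ᵥ φ a) then g (φ a) else ε)
      ≈⟨ ∑-cong Aᵐ (λ a → ∑-cong Aᵏ (λ b → reflexive (indicator-subst b (φ a)))) ⟩
    ∑[ a ∈ Aᵐ ] ∑[ b ∈ Aᵏ ] (if does (b ≟ᵥ φ a) then g b else ε)
      ≈⟨ ∑-comm Aᵐ Aᵏ _ ⟩
    ∑[ b ∈ Aᵏ ] ∑[ a ∈ Aᵐ ] (if does (b ≟ᵥ φ a) then g b else ε)
      ≈⟨ ∑-cong Aᵏ (λ b → fibre b (g b)) ⟩
    ∑[ b ∈ Aᵏ ] (if does (b ≟ᵥ φ (ψ b)) then g b else ε) ∎
    where
    Aᵐ = allTuples n m
    Aᵏ = allTuples n k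

    indicator-subst : ∀ b c → (if does (b ≟ᵥ c) then g c else ε) ≡ (if does (b ≟ᵥ c) then g b else ε)
    indicator-subst b c with b ≟ᵥ c
    ... | yes refl = refl
    ... | no  _      = refl

    preimage : ∀ {a b} → b ≡ φ a → a ≡ ψ b
    preimage {a} refl = sym (ψ∘φ a)

    image : ∀ {a b} → b ≡ φ (ψ b) → a ≡ ψ b → b ≡ φ a
    image b≡φψb refl = b≡φψb

    in-image : ∀ {a b} → b ≡ φ a → b ≡ φ (ψ b)
    in-image b≡φa = trans b≡φa (cong φ (preimage b≡φa))

    fibre : ∀ b x → ∑[ a ∈ Aᵐ ] (if does (b ≟ᵥ φ a) then x else ε) ≈ (if does (b ≟ᵥ φ (ψ b)) then x else ε)
    fibre b x with b ≟ᵥ φ (ψ b)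
    ... | yes b≡φψb = begin
      ∑[ a ∈ Aᵐ ] (if does (b ≟ᵥ φ a) then x else ε)
        ≈⟨ ∑-cong Aᵐ (λ a → reflexive (cong (if_then x else ε)
                                         (does-⇔ (mk⇔ preimage (image b≡φψb)) (b ≟ᵥ φ a) (a ≟ᵥ ψ b)))) ⟩
      ∑[ a ∈ Aᵐ ] (if does (a ≟ᵥ ψ b) then x else ε)
        ≈⟨ ∑-allTuples-indicator (ψ b) x ⟩
      x ∎
    ... | no  b≢φψb = begin
      ∑[ a ∈ Aᵐ ] (if does (b ≟ᵥ φ a) then x else ε)
        ≈⟨ ∑-cong Aᵐ (λ a → reflexive (cong (if_then x else ε)
                                         (dec-false (b ≟ᵥ φ a) (b≢φψb ∘ in-image)))) ⟩
      ∑[ _ ∈ Aᵐ ] ε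
        ≈⟨ ∑-ε Aᵐ ⟩
      ε ∎

override : ∀ {m} {A : Set} → (Var → A) → Vec Var m → Vec A m → Var → A
override f []       []       v = f v
override f (x ∷ xs) (a ∷ as) v = if v ≡ᵇ x then a else override f xs as v

update≗override : ∀ {n m} (s : Assignment n) (xs : Vec Var m) (as : Vec (Fin n) m) v →
                  update s xs as v ≡ override s xs as v
update≗override s []       []       v = refl
update≗override s (x ∷ xs) (a ∷ as) v = cong (if v ≡ᵇ x then a else_) (update≗override s xs as v)

module _ {A : Set} {f : Var → A} where

  override-∉ : ∀ {m} {xs : Vec Var m} (as : Vec A m) {v} → v ∉ xs → override f xs as v ≡ f v
  override-∉ {xs = []}     []       v∉ = refl
  override-∉ {xs = x ∷ xs} (a ∷ as) {v} v∉ rewrite dec-false (v ℕₚ.≟ x) (v∉ ∘ here) = override-∉ as (v∉ ∘ there)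

  override-lookup : ∀ {m} {xs : Vec Var m} (as : Vec A m) → Unique xs → ∀ j → override f xs as (lookup xs j) ≡ lookup as j
  override-lookup {xs = x ∷ xs} (a ∷ as) (x∉xs ∷ _) zero rewrite dec-true (x ℕₚ.≟ x) refl = refl
  override-lookup {xs = x ∷ xs} (a ∷ as) (x∉xs ∷ u) (suc j)
    rewrite dec-false (lookup xs j ℕₚ.≟ x) (lookup⁺ x∉xs j ∘ sym) = override-lookup as u j

  map-override : ∀ {m} {xs : Vec Var m} (as : Vec A m) → Unique xs → map (override f xs as) xs ≡ as
  map-override {xs = xs} as u = Pointwise-≡⇒≡ (ext λ j → trans (lookup-map j _ xs) (override-lookup as u j))

module _ {n m} (s : Assignment n) {xs : Vec Var m} (as : Vec (Fin n) m) where

  update-∉ : ∀ {v} → v ∉ xs → update s xs as v ≡ s v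
  update-∉ v∉xs = trans (update≗override s xs as _) (override-∉ as v∉xs)

  update-lookup : Unique xs → ∀ j → update s xs as (lookup xs j) ≡ lookup as j
  update-lookup u j = trans (update≗override s xs as _) (override-lookup as u j)

  map-update : Unique xs → map (update s xs as) xs ≡ as
  map-update u = trans (map-cong (update≗override s xs as) xs) (map-override as u)

varsBound : ∀ {k} → Vec Var k → ℕ
varsBound []       = 0
varsBound (y ∷ ys) = suc y ⊔ varsBound ys

lookup<varsBound : ∀ {k} (ys : Vec Var k) i → lookup ys i < varsBound ys
lookup<varsBound (y ∷ ys) zero    = m≤m⊔n (suc y) (varsBound ys)
lookup<varsBound (y ∷ ys) (suc i) = <-≤-trans (lookup<varsBound ys i) (m≤n⊔m (suc y) (varsBound ys))

module _ {τ : Vocab} where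

  termBound : Term τ → ℕ
  termBound (var v) = suc v
  termBound (con c) = 0

  termsBound : ∀ {l} → Vec (Term τ) l → ℕ
  termsBound []       = 0
  termsBound (t ∷ ts) = termBound t ⊔ termsBound ts

  varBound : QF τ → ℕ
  varBound (rel R ts) = termsBound ts
  varBound (eq t₁ t₂) = termBound t₁ ⊔ termBound t₂
  varBound (neg φ)    = varBound φ
  varBound (and φ ψ)  = varBound φ ⊔ varBound ψ
  varBound (or φ ψ)   = varBound φ ⊔ varBound ψ

  AgreeBelow : ∀ {n} → ℕ → Assignment n → Assignment n → Set
  AgreeBelow N s₁ s₂ = ∀ v → v < N → s₁ v ≡ s₂ v

  module _ {n} (𝒜 : Structure τ n) {s₁ s₂ : Assignment n} where

    private
      agreeˡ : ∀ {a b} → AgreeBelow (a ⊔ b) s₁ s₂ → AgreeBelow a s₁ s₂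
      agreeˡ {a} {b} s₁≈s₂ v v<a = s₁≈s₂ v (<-≤-trans v<a (m≤m⊔n a b))

      agreeʳ : ∀ {a b} → AgreeBelow (a ⊔ b) s₁ s₂ → AgreeBelow b s₁ s₂
      agreeʳ {a} {b} s₁≈s₂ v v<b = s₁≈s₂ v (<-≤-trans v<b (m≤n⊔m a b))

    evalTerm-agree : ∀ t → AgreeBelow (termBound t) s₁ s₂ → evalTerm 𝒜 s₁ t ≡ evalTerm 𝒜 s₂ t
    evalTerm-agree (var v) s₁≈s₂ = s₁≈s₂ v ≤-refl
    evalTerm-agree (con c) s₁≈s₂ = refl

    evalTerms-agree : ∀ {l} (ts : Vec (Term τ) l) → AgreeBelow (termsBound ts) s₁ s₂ →
                      map (evalTerm 𝒜 s₁) ts ≡ map (evalTerm 𝒜 s₂) ts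
    evalTerms-agree []       s₁≈s₂ = refl
    evalTerms-agree (t ∷ ts) s₁≈s₂ =
      cong₂ _∷_ (evalTerm-agree t (agreeˡ s₁≈s₂)) (evalTerms-agree ts (agreeʳ {termBound t} s₁≈s₂))

    sat-agree : ∀ φ → AgreeBelow (varBound φ) s₁ s₂ → sat 𝒜 s₁ φ ≡ sat 𝒜 s₂ φ
    sat-agree (rel R ts) s₁≈s₂ = cong (relI 𝒜 R) (evalTerms-agree ts s₁≈s₂)
    sat-agree (eq t₁ t₂) s₁≈s₂ =
      cong₂ (λ a b → isYes (a ≟ b)) (evalTerm-agree t₁ (agreeˡ s₁≈s₂)) (evalTerm-agree t₂ (agreeʳ {termBound t₁} s₁≈s₂))
    sat-agree (neg φ)    s₁≈s₂ = cong not (sat-agree φ s₁≈s₂)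
    sat-agree (and φ ψ)  s₁≈s₂ = cong₂ _∧_ (sat-agree φ (agreeˡ s₁≈s₂)) (sat-agree ψ (agreeʳ {varBound φ} s₁≈s₂))
    sat-agree (or φ ψ)   s₁≈s₂ = cong₂ _∨_ (sat-agree φ (agreeˡ s₁≈s₂)) (sat-agree ψ (agreeʳ {varBound φ} s₁≈s₂))

  renameTerm : (Var → Var) → Term τ → Term τ
  renameTerm σ (var v) = var (σ v)
  renameTerm σ (con c) = con c

  rename : (Var → Var) → QF τ → QF τ
  rename σ (rel R ts) = rel R (map (renameTerm σ) ts)
  rename σ (eq t₁ t₂) = eq (renameTerm σ t₁) (renameTerm σ t₂)
  rename σ (neg φ)    = neg (rename σ φ)
  rename σ (and φ ψ)  = and (rename σ φ) (rename σ ψ)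
  rename σ (or φ ψ)   = or (rename σ φ) (rename σ ψ)

  evalTerm-rename : ∀ {n} (𝒜 : Structure τ n) s σ t → evalTerm 𝒜 s (renameTerm σ t) ≡ evalTerm 𝒜 (s ∘ σ) t
  evalTerm-rename 𝒜 s σ (var v) = refl
  evalTerm-rename 𝒜 s σ (con c) = refl

  sat-rename : ∀ {n} (𝒜 : Structure τ n) s σ φ → sat 𝒜 s (rename σ φ) ≡ sat 𝒜 (s ∘ σ) φ
  sat-rename 𝒜 s σ (rel R ts) =
    cong (relI 𝒜 R) (trans (sym (map-∘ _ _ ts)) (map-cong (evalTerm-rename 𝒜 s σ) ts))
  sat-rename 𝒜 s σ (eq t₁ t₂) =
    cong₂ (λ a b → isYes (a ≟ b)) (evalTerm-rename 𝒜 s σ t₁) (evalTerm-rename 𝒜 s σ t₂)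
  sat-rename 𝒜 s σ (neg φ)   = cong not (sat-rename 𝒜 s σ φ)
  sat-rename 𝒜 s σ (and φ ψ) = cong₂ _∧_ (sat-rename 𝒜 s σ φ) (sat-rename 𝒜 s σ ψ)
  sat-rename 𝒜 s σ (or φ ψ)  = cong₂ _∨_ (sat-rename 𝒜 s σ φ) (sat-rename 𝒜 s σ ψ)

  elimOr : QF τ → QF τ
  elimOr (rel R ts) = rel R ts
  elimOr (eq t₁ t₂) = eq t₁ t₂
  elimOr (neg φ)    = neg (elimOr φ)
  elimOr (and φ ψ)  = and (elimOr φ) (elimOr ψ)
  elimOr (or φ ψ)   = neg (and (neg (elimOr φ)) (neg (elimOr ψ)))

  elimOr-negAnd : ∀ φ → NegAnd (elimOr φ)
  elimOr-negAnd (rel R ts) = rel R ts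
  elimOr-negAnd (eq t₁ t₂) = eq t₁ t₂
  elimOr-negAnd (neg φ)    = neg (elimOr-negAnd φ)
  elimOr-negAnd (and φ ψ)  = and (elimOr-negAnd φ) (elimOr-negAnd ψ)
  elimOr-negAnd (or φ ψ)   = neg (and (neg (elimOr-negAnd φ)) (neg (elimOr-negAnd ψ)))

  sat-elimOr : ∀ {n} (𝒜 : Structure τ n) s φ → sat 𝒜 s (elimOr φ) ≡ sat 𝒜 s φ
  sat-elimOr 𝒜 s (rel R ts) = refl
  sat-elimOr 𝒜 s (eq t₁ t₂) = refl
  sat-elimOr 𝒜 s (neg φ)    = cong not (sat-elimOr 𝒜 s φ)
  sat-elimOr 𝒜 s (and φ ψ)  = cong₂ _∧_ (sat-elimOr 𝒜 s φ) (sat-elimOr 𝒜 s ψ)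
  sat-elimOr 𝒜 s (or φ ψ)   = begin
    not (not a ∧ not b)         ≡⟨ deMorgan₁ (not a) (not b) ⟩
    not (not a) ∨ not (not b)   ≡⟨ cong₂ _∨_ (not-involutive a) (not-involutive b) ⟩
    a ∨ b                       ≡⟨ cong₂ _∨_ (sat-elimOr 𝒜 s φ) (sat-elimOr 𝒜 s ψ) ⟩
    sat 𝒜 s φ ∨ sat 𝒜 s ψ       ∎
    where
    open ≡-Reasoning
    a b : Bool
    a = sat 𝒜 s (elimOr φ)
    b = sat 𝒜 s (elimOr ψ)

  ⊤ᶠ : QF τ
  ⊤ᶠ = eq (var 0) (var 0)

  _≐_ : ∀ {l} → Vec (Term τ) l → Vec (Term τ) l → QF τ
  []       ≐ []         = ⊤ᶠ
  (t ∷ ts) ≐ (t′ ∷ ts′) = and (eq t t′) (ts ≐ ts′)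

  ≐-negAnd : ∀ {l} (ts ts′ : Vec (Term τ) l) → NegAnd (ts ≐ ts′)
  ≐-negAnd []       []         = eq _ _
  ≐-negAnd (t ∷ ts) (t′ ∷ ts′) = and (eq t t′) (≐-negAnd ts ts′)

  sat-≐ : ∀ {n l} (𝒜 : Structure τ n) s (ts ts′ : Vec (Term τ) l) →
          sat 𝒜 s (ts ≐ ts′) ≡ does (map (evalTerm 𝒜 s) ts ≟ᵥ map (evalTerm 𝒜 s) ts′)
  sat-≐ 𝒜 s []       []         = trans (isYes≗does (s 0 ≟ s 0)) (dec-true (s 0 ≟ s 0) refl)
  sat-≐ 𝒜 s (t ∷ ts) (t′ ∷ ts′) = cong₂ _∧_ (isYes≗does _) (sat-≐ 𝒜 s ts ts′)

module NormalForm (τ : Vocab) {k m} (xs : Vec Var m) (ys : Vec Var k) (γ : QF τ)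
                  (xs-unique : Unique xs) (xs⊆ys : All (_∈ ys) xs) where

  N : ℕ
  N = varBound γ ⊔ varsBound ys

  us : Vec Var k
  us = tabulate (λ i → N + toℕ i)

  us-unique : Unique us
  us-unique = tabulate⁺ (λ e → toℕ-injective (+-cancelˡ-≡ N _ _ e))

  <N⇒∉us : ∀ {v} → v < N → v ∉ us
  <N⇒∉us {v} v<N v∈us = <⇒≱ v<N (subst (N ≤_) v≡uᵢ (m≤m+n N _))
    where
    v≡uᵢ : N + toℕ (index v∈us) ≡ v
    v≡uᵢ = sym (trans (lookup-index v∈us) (lookup∘tabulate _ (index v∈us)))

  pos : Fin m → Fin k
  pos j = index (lookup⁺ xs⊆ys j)

  lookup-pos : ∀ j → lookup ys (pos j) ≡ lookup xs j
  lookup-pos j = sym (lookup-index (lookup⁺ xs⊆ys j))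

  σ : Var → Var
  σ = override id xs (tabulate (lookup us ∘ pos))

  σ-lookup : ∀ j → σ (lookup xs j) ≡ lookup us (pos j)
  σ-lookup j = trans (override-lookup _ xs-unique j) (lookup∘tabulate _ j)

  γ′ : QF τ
  γ′ = elimOr (rename σ γ)

  -- For a bound yᵢ both sides are the same variable; for a free yᵢ this pins uᵢ to the value of yᵢ.
  us≐σys : QF τ
  us≐σys = map var us ≐ map (var ∘ σ) ys

  δ : QF τ
  δ = and us≐σys γ′

  δ-negAnd : NegAnd δ
  δ-negAnd = and (≐-negAnd _ _) (elimOr-negAnd _)

  module Semantics {n} (𝒜 : Structure τ n) (s : Assignment n) where

    bind : Vec (Fin n) m → Assignment n
    bind a = update s xs a

    bindᵤ : Vec (Fin n) k → Assignment n
    bindᵤ b = update s us b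

    φ : Vec (Fin n) m → Vec (Fin n) k
    φ a = map (bind a) ys

    ψ : Vec (Fin n) k → Vec (Fin n) m
    ψ b = map (bindᵤ b ∘ σ) xs

    bindᵤ∘σ≗bind∘ψ : ∀ b v → v < N → bindᵤ b (σ v) ≡ bind (ψ b) v
    bindᵤ∘σ≗bind∘ψ b v v<N with v ∈? xs
    ... | yes v∈xs = subst (λ v → bindᵤ b (σ v) ≡ bind (ψ b) v) (sym (lookup-index v∈xs)) (on-xs (index v∈xs))
      where
      on-xs : ∀ j → bindᵤ b (σ (lookup xs j)) ≡ bind (ψ b) (lookup xs j)
      on-xs j = sym (trans (update-lookup s (ψ b) xs-unique j) (lookup-map j _ xs))
    ... | no v∉xs = begin
      bindᵤ b (σ v) ≡⟨ cong (bindᵤ b) (override-∉ _ v∉xs) ⟩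
      bindᵤ b v     ≡⟨ update-∉ s b (<N⇒∉us v<N) ⟩
      s v           ≡⟨ update-∉ s (ψ b) v∉xs ⟨
      bind (ψ b) v  ∎
      where open ≡-Reasoning

    sat-γ′ : ∀ b → sat 𝒜 (bindᵤ b) γ′ ≡ sat 𝒜 (bind (ψ b)) γ
    sat-γ′ b = begin
      sat 𝒜 (bindᵤ b) (elimOr (rename σ γ)) ≡⟨ sat-elimOr 𝒜 (bindᵤ b) (rename σ γ) ⟩
      sat 𝒜 (bindᵤ b) (rename σ γ)          ≡⟨ sat-rename 𝒜 (bindᵤ b) σ γ ⟩
      sat 𝒜 (bindᵤ b ∘ σ) γ                 ≡⟨ sat-agree 𝒜 γ (λ v v<γ → bindᵤ∘σ≗bind∘ψ b v (<-≤-trans v<γ (m≤m⊔n _ _))) ⟩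
      sat 𝒜 (bind (ψ b)) γ                  ∎
      where open ≡-Reasoning

    sat-us≐σys : ∀ b → sat 𝒜 (bindᵤ b) us≐σys ≡ does (b ≟ᵥ φ (ψ b))
    sat-us≐σys b = trans (sat-≐ 𝒜 (bindᵤ b) (map var us) (map (var ∘ σ) ys)) (cong₂ (λ c d → does (c ≟ᵥ d)) us-side ys-side)
      where
      us-side : map (evalTerm 𝒜 (bindᵤ b)) (map var us) ≡ b
      us-side = trans (sym (map-∘ _ var us)) (map-update s b us-unique)
      ys-side : map (evalTerm 𝒜 (bindᵤ b)) (map (var ∘ σ) ys) ≡ φ (ψ b)
      ys-side = trans (sym (map-∘ _ _ ys)) (Pointwise-≡⇒≡ (ext λ i → begin
        lookup (map (bindᵤ b ∘ σ) ys) i ≡⟨ lookup-map i _ ys ⟩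
        bindᵤ b (σ (lookup ys i))      ≡⟨ bindᵤ∘σ≗bind∘ψ b _ (<-≤-trans (lookup<varsBound ys i) (m≤n⊔m _ _)) ⟩
        bind (ψ b) (lookup ys i)       ≡⟨ lookup-map i _ ys ⟨
        lookup (φ (ψ b)) i             ∎))
        where open ≡-Reasoning

    ψ∘φ : ∀ a → ψ (φ a) ≡ a
    ψ∘φ a = Pointwise-≡⇒≡ (ext λ j → begin
      lookup (ψ (φ a)) j                  ≡⟨ lookup-map j _ xs ⟩
      bindᵤ (φ a) (σ (lookup xs j))       ≡⟨ cong (bindᵤ (φ a)) (σ-lookup j) ⟩
      bindᵤ (φ a) (lookup us (pos j))     ≡⟨ update-lookup s (φ a) us-unique (pos j) ⟩
      lookup (φ a) (pos j)                ≡⟨ lookup-map (pos j) _ ys ⟩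
      bind a (lookup ys (pos j))          ≡⟨ cong (bind a) (lookup-pos j) ⟩
      bind a (lookup xs j)                ≡⟨ update-lookup s a xs-unique j ⟩
      lookup a j                          ∎)
      where open ≡-Reasoning

  sumTerm-normalForm : (M : CommutativeMonoid 0ℓ 0ℓ) {n : ℕ} (𝒜 : Structure τ n)
                       (F : Vec (Fin n) k → CommutativeMonoid.Carrier M) (s : Assignment n) →
                       CommutativeMonoid._≈_ M (sumTerm M 𝒜 F s xs ys γ) (sumTerm M 𝒜 F s us us δ)
  sumTerm-normalForm M {n} 𝒜 F s = begin
    sumTerm M 𝒜 F s xs ys γ
      ≈⟨ foldr-if≈∑ Aᵐ (λ a → sat 𝒜 (bind a) γ) (F ∘ φ) ⟩
    ∑[ a ∈ Aᵐ ] (if sat 𝒜 (bind a) γ then F (φ a) else ε)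
      ≈⟨ ∑-cong Aᵐ (λ a → reflexive (if-cong (sat-γ′∘φ a))) ⟨
    ∑[ a ∈ Aᵐ ] g (φ a)
      ≈⟨ ∑-image φ ψ ψ∘φ g ⟩
    ∑[ b ∈ Aᵏ ] (if does (b ≟ᵥ φ (ψ b)) then g b else ε)
      ≈⟨ ∑-cong Aᵏ (λ b → reflexive (split-δ b)) ⟨
    ∑[ b ∈ Aᵏ ] (if sat 𝒜 (bindᵤ b) δ then F (map (bindᵤ b) us) else ε)
      ≈⟨ foldr-if≈∑ Aᵏ (λ b → sat 𝒜 (bindᵤ b) δ) (λ b → F (map (bindᵤ b) us)) ⟨
    sumTerm M 𝒜 F s us us δ ∎
    where
    open CommutativeMonoid M using (ε; reflexive; setoid)
    open Sums M
    open import Relation.Binary.Reasoning.Setoid setoid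
    Aᵐ = allTuples n m
    Aᵏ = allTuples n k
    open Semantics 𝒜 s
    g : Vec (Fin n) k → CommutativeMonoid.Carrier M
    g b = if sat 𝒜 (bindᵤ b) γ′ then F b else ε
    sat-γ′∘φ : ∀ a → sat 𝒜 (bindᵤ (φ a)) γ′ ≡ sat 𝒜 (bind a) γ
    sat-γ′∘φ a = trans (sat-γ′ (φ a)) (cong (λ a → sat 𝒜 (bind a) γ) (ψ∘φ a))
    split-δ : ∀ b → (if sat 𝒜 (bindᵤ b) δ then F (map (bindᵤ b) us) else ε)
                    ≡ (if does (b ≟ᵥ φ (ψ b)) then g b else ε)
    split-δ b = trans (if-∧ (sat 𝒜 (bindᵤ b) us≐σys))
                      (cong₂ (λ c x → if c then (if sat 𝒜 (bindᵤ b) γ′ then F x else ε) else ε)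
                             (sat-us≐σys b) (map-update s b us-unique))

lemma1 : (τ : Vocab) (k m : ℕ) (xs : Vec Var m) (ys : Vec Var k) (γ : QF τ) →
         Unique xs → Unique ys → All (λ x → x ∈ ys) xs →
         Σ (Vec Var k) λ us → Σ (QF τ) λ δ →
           Unique us × NegAnd δ ×
           ((M : CommutativeMonoid 0ℓ 0ℓ) (n : ℕ) (𝒜 : Structure τ n)
            (F : Vec (Fin n) k → CommutativeMonoid.Carrier M) (s : Assignment n) →
            CommutativeMonoid._≈_ M (sumTerm M 𝒜 F s xs ys γ) (sumTerm M 𝒜 F s us us δ))
lemma1 τ k m xs ys γ xs-unique _ xs⊆ys =
  us , δ , us-unique , δ-negAnd , λ M n → sumTerm-normalForm M
  where open NormalForm τ xs ys γ xs-unique xs⊆ys
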